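{- For the elementary cellular automaton $F_{104}$ and every nonempty finite word $u\in\{0,1\}^*$, $D(\textsc{SInv}_{F_{104},u,n})\in O(1)$ as $n\to\infty$.
   Context: The ECA with Wolfram number $N$ is $F_N:\{0,1\}^{\mathbb{Z}}\to\{0,1\}^{\mathbb{Z}}$, $(F_N(x))_i=f_N(x_{i-1},x_i,x_{i+1})$, where $f_N(a,b,c)$ is the bit of index $4a+2b+c$ of $N$ in binary. For a nonempty word $u$, $p_u\in\{0,1\}^{\mathbb{Z}}$ is $(p_u)_i=u_{i\bmod |u|}$; for a finite word $x$, $p_u[x]$ equals $x$ on positions $\{0,\dots,|x|-1\}$ and $p_u$ elsewhere. $\textsc{SInv}_{F,u,n}:\{0,1\}^n\to\{0,1\}$ maps $x$ to $1$ iff there is an integer $w$ such that for every $t\ge 0$ the set of positions where $F^t(p_u)$ and $F^t(p_u[x])$ differ is contained in an interval of length $w$. For finite sets $X,Y,Z$ and $g:X\times Y\to Z$, $D(g)$ is the minimal depth of a deterministic two-party communication protocol tree computing $g$ (Alice knows $x$, Bob knows $y$; internal nodes are labelled by a function of $x$ alone or of $y$ alone to $\{\mathrm{l},\mathrm{r}\}$, leaves by outputs). For $g:\{0,1\}^m\to Z$, $D(g)=\max_{0\le i\le m} D(g_i)$ with $g_i(x,y)=g(xy)$ for $x\in\{0,1\}^i$, $y\in\{0,1\}^{m-i}$. -}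

module Defs where

open import Data.Bool using (Bool; true; false; if_then_else_)
open import Data.Nat as ℕ using (ℕ; zero; suc; _⊔_; ⌊_/2⌋; _≡ᵇ_; _<?_)
open import Data.Integer as ℤ using (ℤ; +_; -[1+_]; _%ℕ_; _≤_; _<_)
open import Data.Integer.DivMod using (n%ℕd<d)
open import Data.Fin using (Fin; fromℕ<)
open import Data.Vec using (Vec; lookup; _++_)
open import Data.Product using (Σ; ∃; _×_; _,_)
open import Relation.Nullary using (yes; no; ¬_)
open import Relation.Binary.PropositionalEquality using (_≡_)
open import Function.Bundles using (_⇔_)

Config : Set
Config = ℤ → Bool

bit : ℕ → ℕ → Bool
bit N zero    = N ℕ.% 2 ≡ᵇ 1
bit N (suc k) = bit ⌊ N /2⌋ k

toℕ : Bool → ℕ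
toℕ false = 0
toℕ true  = 1

localRule : ℕ → Bool → Bool → Bool → Bool
localRule N a b c = bit N (4 ℕ.* toℕ a ℕ.+ 2 ℕ.* toℕ b ℕ.+ toℕ c)

ECA : ℕ → Config → Config
ECA N x i = localRule N (x (i ℤ.- ℤ.1ℤ)) (x i) (x (i ℤ.+ ℤ.1ℤ))

iterate : (Config → Config) → ℕ → Config → Config
iterate F zero    x = x
iterate F (suc t) x = F (iterate F t x)

periodic : ∀ {k} → Vec Bool (suc k) → Config
periodic {k} u i = lookup u (fromℕ< (n%ℕd<d i (suc k)))

patch : ∀ {k n} → Vec Bool (suc k) → Vec Bool n → Config
patch {k} {n} u x (+ m) with m <? n
... | yes m<n = lookup x (fromℕ< m<n)
... | no  _   = periodic u (+ m)
patch u x -[1+ m ] = periodic u -[1+ m ]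

DiffWithin : ℕ → Config → Config → Set
DiffWithin w c d = Σ ℤ λ a → ∀ i → ¬ (c i ≡ d i) → (a ≤ i) × (i < a ℤ.+ + w)

-- SInv_{F,u,n}(x) = 1 iff this proposition holds
SInv : (Config → Config) → ∀ {k} → Vec Bool (suc k) → ∀ {n} → Vec Bool n → Set
SInv F u x = Σ ℕ λ w → ∀ (t : ℕ) →
  DiffWithin w (iterate F t (periodic u)) (iterate F t (patch u x))

data Protocol (X Y Z : Set) : Set where
  leaf  : Z → Protocol X Y Z
  alice : (X → Bool) → Protocol X Y Z → Protocol X Y Z → Protocol X Y Z
  bob   : (Y → Bool) → Protocol X Y Z → Protocol X Y Z → Protocol X Y Z

depth : ∀ {X Y Z} → Protocol X Y Z → ℕ
depth (leaf _)      = 0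
depth (alice _ l r) = suc (depth l ⊔ depth r)
depth (bob _ l r)   = suc (depth l ⊔ depth r)

run : ∀ {X Y Z} → Protocol X Y Z → X → Y → Z
run (leaf z)      x y = z
run (alice f l r) x y = if f x then run r x y else run l x y
run (bob g l r)   x y = if g y then run r x y else run l x y

ComputesPred : ∀ {X Y} → Protocol X Y Bool → (X → Y → Set) → Set
ComputesPred {X} {Y} P G = ∀ (x : X) (y : Y) → (run P x y ≡ true) ⇔ G x y

DSplitLe : (∀ {n} → Vec Bool n → Set) → ℕ → ℕ → ℕ → Set
DSplitLe G i j d =
  Σ (Protocol (Vec Bool i) (Vec Bool j) Bool) λ P →
    (depth P ℕ.≤ d) × ComputesPred P (λ x y → G (x ++ y))

-- D(SInv_{F,u,n}) ≤ d, i.e. max over all splits i + j = n of D(g_i) ≤ d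
DLe : (∀ {n} → Vec Bool n → Set) → ℕ → ℕ → Set
DLe G n d = ∀ i j → i ℕ.+ j ≡ n → DSplitLe G i j d

-- Rule 104 maps x00 and 00x to 0, so a block 00 (a wall) is permanent and no
-- information crosses it.  Let b = p_u.  If one of b, F b, F² b, F³ b contains
-- a wall, then by spatial periodicity it has walls arbitrarily far on both
-- sides; a perturbation on [0, n) spreads at speed one, is enclosed between two
-- of them, and SInv is constantly true.  Otherwise a finite check shows that
-- F² b = b, so b never contains a wall.  A second finite check shows that any
-- difference from b produces a wall in the perturbed orbit, and a third one that
-- such a wall keeps growing to the left; as b has no walls, the difference is
-- then unbounded.  So SInv(x) holds iff x agrees with p_u on [0, n), which
-- Alice and Bob decide by each checking their own half.

module Submission where

open import Defs
open import Data.Bool using (Bool; true; false; not; _∧_; _∨_; T)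
open import Data.Unit using (tt)
open import Data.Bool.Properties using (T-∨; T-∧; T-not-≡) renaming (_≟_ to _≟ᵇ_)
open import Data.Nat as ℕ using (ℕ; zero; suc; z≤n; s≤s; z<s)
import Data.Nat.Properties as ℕ
import Data.Nat.DivMod as ℕ
open import Data.Integer as ℤ
  using (ℤ; +_; -[1+_]; 0ℤ; 1ℤ; -1ℤ; _+_; _-_; -_; _*_; _≤_; _<_; +≤+; +<+; _%ℕ_; _/ℕ_)
import Data.Integer.Properties as ℤ
open import Data.Integer.DivMod using (n%ℕd<d; a≡a%ℕn+[a/ℕn]*n)
open import Data.Integer.Tactic.RingSolver using (solve-∀)
open import Data.Fin as Fin using (Fin; #_; fromℕ<)
import Data.Fin.Properties as Finₚ
open import Data.Vec using (Vec; []; _∷_; head; lookup; tabulate; _++_)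
open import Data.Vec.Properties using (++-injective; ≡-dec; tabulate∘lookup; tabulate-cong)
open import Data.Product using (Σ; ∃-syntax; _×_; _,_; proj₁; proj₂)
open import Data.Sum using (_⊎_; inj₁; inj₂; [_,_]′)
open import Data.Empty using (⊥-elim)
open import Function using (_∘_; _⇔_; mk⇔; Equivalence)
open import Function.Properties.Equivalence using () renaming (sym to ⇔-sym; trans to ⇔-trans)
open import Relation.Nullary using (¬_; Dec; yes; no; contradiction)
open import Relation.Nullary.Decidable using (⌊_⌋; toWitness; decidable-stable)
open import Relation.Binary.Definitions using (DecidableEquality; tri<; tri≈; tri>)
open import Relation.Binary.PropositionalEquality

private
  variable
    a b j p : ℤ
    k m n : ℕ
    c d : Config

i+1-1≡i : ∀ i → i + 1ℤ - 1ℤ ≡ i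
i+1-1≡i = solve-∀

i-1+1≡i : ∀ i → i - 1ℤ + 1ℤ ≡ i
i-1+1≡i = solve-∀

i-a+a≡i : ∀ i a → i - a + a ≡ i
i-a+a≡i = solve-∀

a+1+n≡a+[1+n] : ∀ a n → a + 1ℤ + + n ≡ a + + suc n
a+1+n≡a+[1+n] a n = lemma a (+ n)
  where
  lemma : ∀ a n → a + 1ℤ + n ≡ a + (1ℤ + n)
  lemma = solve-∀

i<i+1 : ∀ i → i < i + 1ℤ
i<i+1 i = subst (i <_) (ℤ.+-comm 1ℤ i) (ℤ.suc[i]≤j⇒i<j ℤ.≤-refl)

i-1<i : ∀ i → i - 1ℤ < i
i-1<i i = subst (i - 1ℤ <_) (i-1+1≡i i) (i<i+1 (i - 1ℤ))

<⇒+1≤ : a < b → a + 1ℤ ≤ b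
<⇒+1≤ {a} a<b = subst (_≤ _) (ℤ.+-comm 1ℤ a) (ℤ.i<j⇒suc[i]≤j a<b)

<+1⇒≤ : a < b + 1ℤ → a ≤ b
<+1⇒≤ {a} {b} a<b+1 = subst₂ _≤_ (i+1-1≡i a) (i+1-1≡i b) (ℤ.+-monoˡ-≤ -1ℤ (<⇒+1≤ a<b+1))

+1<+1⇒< : a + 1ℤ < b + 1ℤ → a < b
+1<+1⇒< {a} {b} lt = subst₂ _<_ (i+1-1≡i a) (i+1-1≡i b) (ℤ.+-monoˡ-< -1ℤ lt)

-- Rule 104 and walls

F : Config → Config
F = ECA 104

localRule-cong : ∀ {x x′ y y′ z z′} → x ≡ x′ → y ≡ y′ → z ≡ z′ →
                 localRule 104 x y z ≡ localRule 104 x′ y′ z′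
localRule-cong refl refl refl = refl

F-local : ∀ c d j → c (j - 1ℤ) ≡ d (j - 1ℤ) → c j ≡ d j → c (j + 1ℤ) ≡ d (j + 1ℤ) →
          F c j ≡ F d j
F-local c d j = localRule-cong

F-translate : ∀ c a i → F (λ x → c (x + a)) i ≡ F c (i + a)
F-translate c a i =
  localRule-cong (cong c (i-1+a≡i+a-1 i a)) (refl {x = c (i + a)}) (cong c (i+1+a≡i+a+1 i a))
  where
  i-1+a≡i+a-1 : ∀ i a → i - 1ℤ + a ≡ i + a - 1ℤ
  i-1+a≡i+a-1 = solve-∀
  i+1+a≡i+a+1 : ∀ i a → i + 1ℤ + a ≡ i + a + 1ℤ
  i+1+a≡i+a+1 = solve-∀

F-cong : c ≗ d → F c ≗ F d
F-cong {c} {d} c≗d i = F-local c d i (c≗d (i - 1ℤ)) (c≗d i) (c≗d (i + 1ℤ))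

iterate-cong : ∀ t → c ≗ d → iterate F t c ≗ iterate F t d
iterate-cong zero    c≗d = c≗d
iterate-cong (suc t) c≗d = F-cong (iterate-cong t c≗d)

iterate-suc : ∀ t c → iterate F (suc t) c ≡ iterate F t (F c)
iterate-suc zero    c = refl
iterate-suc (suc t) c = cong F (iterate-suc t c)

iterate-+ : ∀ s t c → iterate F (s ℕ.+ t) c ≡ iterate F s (iterate F t c)
iterate-+ zero    t c = refl
iterate-+ (suc s) t c = cong F (iterate-+ s t c)

record Wall (c : Config) (j : ℤ) : Set where
  constructor wall
  field
    left  : c j ≡ false
    right : c (j + 1ℤ) ≡ false

NoWall : Config → Set
NoWall c = ∀ j → ¬ Wall c j

wall? : ∀ c j → Dec (Wall c j)
wall? c j with c j ≟ᵇ false | c (j + 1ℤ) ≟ᵇ false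
... | yes c₀ | yes c₁ = yes (wall c₀ c₁)
... | no ¬c₀ | _      = no (¬c₀ ∘ Wall.left)
... | _      | no ¬c₁ = no (¬c₁ ∘ Wall.right)

wall-≗ : c ≗ d → Wall c j → Wall d j
wall-≗ c≗d (wall c₀ c₁) = wall (trans (sym (c≗d _)) c₀) (trans (sym (c≗d _)) c₁)

x00↦0 : ∀ x → localRule 104 x false false ≡ false
x00↦0 false = refl
x00↦0 true  = refl

00x↦0 : ∀ x → localRule 104 false false x ≡ false
00x↦0 false = refl
00x↦0 true  = refl

wall-F : Wall c j → Wall (F c) j
wall-F {c} {j} (wall c₀ c₁) = wall
  (trans (cong₂ (localRule 104 (c (j - 1ℤ))) c₀ c₁) (x00↦0 (c (j - 1ℤ))))
  (trans (cong₂ (λ x y → localRule 104 x y (c (j + 1ℤ + 1ℤ))) (trans (cong c (i+1-1≡i j)) c₀) c₁)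
         (00x↦0 (c (j + 1ℤ + 1ℤ))))

wall-iterate : ∀ t → Wall c j → Wall (iterate F t c) j
wall-iterate zero    w = w
wall-iterate (suc t) w = wall-F (wall-iterate t w)

wall-shift : ∀ a → (∀ i → c (i + a) ≡ c i) → Wall c j ⇔ Wall c (j + a)
wall-shift {c} {j} a invariant = mk⇔
  (λ (wall c₀ c₁) → wall (trans (invariant j) c₀)
                         (trans (cong c (j+a+1≡j+1+a j a)) (trans (invariant (j + 1ℤ)) c₁)))
  (λ (wall c₀ c₁) → wall (trans (sym (invariant j)) c₀)
                         (trans (sym (invariant (j + 1ℤ))) (trans (cong c (sym (j+a+1≡j+1+a j a))) c₁)))
  where
  j+a+1≡j+1+a : ∀ j a → j + a + 1ℤ ≡ j + 1ℤ + a
  j+a+1≡j+1+a = solve-∀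

-- Spatial periodicity

Periodic : ℕ → Config → Set
Periodic p c = ∀ i → c (i + + p) ≡ c i

periodic-F : Periodic m c → Periodic m (F c)
periodic-F {m} {c} per i = trans (sym (F-translate c (+ m) i)) (F-cong per i)

periodic-iterate : ∀ t → Periodic m c → Periodic m (iterate F t c)
periodic-iterate zero    per = per
periodic-iterate (suc t) per = periodic-F (periodic-iterate t per)

periodic-+ : Periodic m c → ∀ n i → c (i + + (n ℕ.* m)) ≡ c i
periodic-+ {c = c} per zero    i = cong c (ℤ.+-identityʳ i)
periodic-+ {m} {c} per (suc n) i = begin
  c (i + + (m ℕ.+ n ℕ.* m))     ≡⟨ cong c (sym (ℤ.+-assoc i (+ m) (+ (n ℕ.* m)))) ⟩
  c (i + + m + + (n ℕ.* m))     ≡⟨ periodic-+ per n (i + + m) ⟩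
  c (i + + m)                   ≡⟨ per i ⟩
  c i                           ∎
  where open ≡-Reasoning

periodic-- : Periodic m c → ∀ n i → c (i - + (n ℕ.* m)) ≡ c i
periodic-- {m} {c} per n i =
  trans (sym (periodic-+ per n (i - + (n ℕ.* m)))) (cong c (i-a+a≡i i (+ (n ℕ.* m))))

periodic-ℤ : Periodic m c → ∀ q i → c (i + q * + m) ≡ c i
periodic-ℤ {m} {c} per (+ n)    i =
  trans (cong (λ x → c (i + x)) (sym (ℤ.pos-* n m))) (periodic-+ per n i)
periodic-ℤ {m} {c} per -[1+ n ] i =
  trans (cong (λ x → c (i + x)) -[1+n]*m≡-[[1+n]*m]) (periodic-- per (suc n) i)
  where
  -[1+n]*m≡-[[1+n]*m] : -[1+ n ] * + m ≡ - + (suc n ℕ.* m)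
  -[1+n]*m≡-[[1+n]*m] =
    trans (sym (ℤ.neg-distribˡ-* (+ suc n) (+ m))) (cong -_ (sym (ℤ.pos-* (suc n) m)))

-[1+m]%ℕd : ∀ m d .{{_ : ℕ.NonZero d}} → -[1+ m ] %ℕ d ≡ (d ℕ.∸ suc m ℕ.% d) ℕ.% d
-[1+m]%ℕd m d@(suc d-1) with suc m ℕ.% d
... | zero  = sym (ℕ.n%n≡0 d)
... | suc r = sym (ℕ.m<n⇒m%n≡m (s≤s (ℕ.m∸n≤m d-1 r)))

[i+d]%ℕd≡i%ℕd : ∀ i d .{{_ : ℕ.NonZero d}} → (i + + d) %ℕ d ≡ i %ℕ d
[i+d]%ℕd≡i%ℕd (+ m)    d = ℕ.[m+n]%n≡m%n m d
[i+d]%ℕd≡i%ℕd -[1+ m ] d with ℕ.<-cmp (suc m) d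
... | tri< 1+m<d _ _ = begin
  (d ℤ.⊖ suc m) %ℕ d               ≡⟨ cong (_%ℕ d) (ℤ.⊖-≥ (ℕ.<⇒≤ 1+m<d)) ⟩
  (d ℕ.∸ suc m) ℕ.% d              ≡⟨ cong (λ x → (d ℕ.∸ x) ℕ.% d) (ℕ.m<n⇒m%n≡m 1+m<d) ⟨
  (d ℕ.∸ suc m ℕ.% d) ℕ.% d        ≡⟨ -[1+m]%ℕd m d ⟨
  -[1+ m ] %ℕ d                    ∎
  where open ≡-Reasoning
... | tri≈ _ refl _ = begin
  (suc m ℤ.⊖ suc m) %ℕ suc m                   ≡⟨ cong (_%ℕ suc m) (ℤ.n⊖n≡0 (suc m)) ⟩
  0                                            ≡⟨ ℕ.n%n≡0 (suc m) ⟨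
  suc m ℕ.% suc m                              ≡⟨ cong (λ x → (suc m ℕ.∸ x) ℕ.% suc m) (ℕ.n%n≡0 (suc m)) ⟨
  (suc m ℕ.∸ suc m ℕ.% suc m) ℕ.% suc m        ≡⟨ -[1+m]%ℕd m (suc m) ⟨
  -[1+ m ] %ℕ suc m                            ∎
  where open ≡-Reasoning
... | tri> _ _ d<1+m = begin
  (d ℤ.⊖ suc m) %ℕ d                    ≡⟨ cong (_%ℕ d) (ℤ.⊖-< d<1+m) ⟩
  (- + (suc m ℕ.∸ d)) %ℕ d              ≡⟨ cong (λ x → (- + x) %ℕ d) (ℕ.+-∸-assoc 1 d≤m) ⟩
  -[1+ m ℕ.∸ d ] %ℕ d                   ≡⟨ -[1+m]%ℕd (m ℕ.∸ d) d ⟩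
  (d ℕ.∸ suc (m ℕ.∸ d) ℕ.% d) ℕ.% d     ≡⟨ cong (λ x → (d ℕ.∸ x) ℕ.% d) [1+m-d]%d≡[1+m]%d ⟩
  (d ℕ.∸ suc m ℕ.% d) ℕ.% d             ≡⟨ -[1+m]%ℕd m d ⟨
  -[1+ m ] %ℕ d                         ∎
  where
  open ≡-Reasoning
  d≤m : d ℕ.≤ m
  d≤m = ℕ.s≤s⁻¹ d<1+m
  [1+m-d]%d≡[1+m]%d : suc (m ℕ.∸ d) ℕ.% d ≡ suc m ℕ.% d
  [1+m-d]%d≡[1+m]%d =
    trans (sym (ℕ.[m+n]%n≡m%n (suc (m ℕ.∸ d)) d)) (cong (λ x → suc x ℕ.% d) (ℕ.m∸n+n≡m d≤m))

periodic-periodic : ∀ {k} (u : Vec Bool (suc k)) → Periodic (suc k) (periodic u)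
periodic-periodic {k} u i =
  cong (lookup u) (Finₚ.fromℕ<-cong _ _ ([i+d]%ℕd≡i%ℕd i (suc k))
                                        (n%ℕd<d (i + + suc k) (suc k)) (n%ℕd<d i (suc k)))

wall-%ℕ : Periodic (suc k) c → Wall c j → Wall c (+ (j %ℕ suc k))
wall-%ℕ {k} {c} {j} per w =
  Equivalence.from (wall-shift (j /ℕ suc k * + suc k) (periodic-ℤ per (j /ℕ suc k)))
    (subst (Wall c) (a≡a%ℕn+[a/ℕn]*n j (suc k)) w)

Walled : Config → Set
Walled c = ∀ B → (∃[ L ] Wall c L × L ≤ B) × (∃[ R ] Wall c R × B ≤ R)

i≤+∣i∣ : ∀ i → i ≤ + ℤ.∣ i ∣
i≤+∣i∣ (+ n)    = ℤ.≤-refl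
i≤+∣i∣ -[1+ n ] = ℤ.-≤+

periodic-walled : Periodic (suc k) c → Wall c j → Walled c
periodic-walled {k} {c} {j} per w B =
  (j - + (q ℕ.* suc k) , Equivalence.to (wall-shift _ (periodic-- per q)) w , L≤B) ,
  (j + + (q′ ℕ.* suc k) , Equivalence.to (wall-shift _ (periodic-+ per q′)) w , B≤R)
  where
  open ℤ.≤-Reasoning
  q  = ℤ.∣ j - B ∣
  q′ = ℤ.∣ B - j ∣
  j-[j-B]≡B : ∀ j B → j - (j - B) ≡ B
  j-[j-B]≡B = solve-∀
  j+[B-j]≡B : ∀ j B → j + (B - j) ≡ B
  j+[B-j]≡B = solve-∀
  L≤B : j - + (q ℕ.* suc k) ≤ B
  L≤B = begin
    j - + (q ℕ.* suc k)  ≤⟨ ℤ.+-monoʳ-≤ j (ℤ.neg-mono-≤ (+≤+ (ℕ.m≤m*n q (suc k)))) ⟩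
    j - + q              ≤⟨ ℤ.+-monoʳ-≤ j (ℤ.neg-mono-≤ (i≤+∣i∣ (j - B))) ⟩
    j - (j - B)          ≡⟨ j-[j-B]≡B j B ⟩
    B                    ∎
  B≤R : B ≤ j + + (q′ ℕ.* suc k)
  B≤R = begin
    B                     ≡⟨ j+[B-j]≡B j B ⟨
    j + (B - j)           ≤⟨ ℤ.+-monoʳ-≤ j (i≤+∣i∣ (B - j)) ⟩
    j + + q′              ≤⟨ ℤ.+-monoʳ-≤ j (+≤+ (ℕ.m≤m*n q′ (suc k))) ⟩
    j + + (q′ ℕ.* suc k)  ∎

-- Perturbations enclosed by walls

record AgreeOutside (l h : ℤ) (c d : Config) : Set where
  constructor agreeOutside
  field
    below : ∀ i → i < l → c i ≡ d i
    above : ∀ i → h ≤ i → c i ≡ d i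

agreeOutside-widen : ∀ {l l′ h h′} → l′ ≤ l → h ≤ h′ →
                     AgreeOutside l h c d → AgreeOutside l′ h′ c d
agreeOutside-widen l′≤l h≤h′ (agreeOutside below above) = agreeOutside
  (λ i i<l′ → below i (ℤ.<-≤-trans i<l′ l′≤l))
  (λ i h′≤i → above i (ℤ.≤-trans h≤h′ h′≤i))

agreeOutside-F : ∀ {l h} → AgreeOutside l h c d → AgreeOutside (l - 1ℤ) (h + 1ℤ) (F c) (F d)
agreeOutside-F {c} {d} {l} {h} (agreeOutside below above) = agreeOutside
  (λ i i<l-1 → let i<l = ℤ.<-trans i<l-1 (i-1<i l) in
    F-local c d i (below _ (ℤ.<-trans (i-1<i i) i<l)) (below i i<l)
      (below _ (subst (i + 1ℤ <_) (i-1+1≡i l) (ℤ.+-monoˡ-< 1ℤ i<l-1))))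
  (λ i h+1≤i → let h≤i = ℤ.≤-trans (ℤ.<⇒≤ (i<i+1 h)) h+1≤i in
    F-local c d i (above _ (subst (_≤ i - 1ℤ) (i+1-1≡i h) (ℤ.+-monoˡ-≤ -1ℤ h+1≤i))) (above i h≤i)
      (above _ (ℤ.≤-trans h≤i (ℤ.<⇒≤ (i<i+1 i)))))

agreeOutside-iterate : ∀ {l h} → AgreeOutside l h c d → ∀ t →
                       AgreeOutside (l - + t) (h + + t) (iterate F t c) (iterate F t d)
agreeOutside-iterate {l = l} {h} agree zero =
  agreeOutside-widen (ℤ.≤-reflexive (ℤ.+-identityʳ l)) (ℤ.≤-reflexive (sym (ℤ.+-identityʳ h))) agree
agreeOutside-iterate {l = l} {h} agree (suc t) =
  agreeOutside-widen (ℤ.≤-reflexive (l-t-1≡l-[1+t] l (+ t))) (ℤ.≤-reflexive (h+t+1≡h+[1+t] h (+ t)))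
    (agreeOutside-F (agreeOutside-iterate agree t))
  where
  l-t-1≡l-[1+t] : ∀ l t → l - (1ℤ + t) ≡ l - t - 1ℤ
  l-t-1≡l-[1+t] = solve-∀
  h+t+1≡h+[1+t] : ∀ h t → h + t + 1ℤ ≡ h + (1ℤ + t)
  h+t+1≡h+[1+t] = solve-∀

wall-agree : Wall c j → c j ≡ d j → c (j + 1ℤ) ≡ d (j + 1ℤ) → Wall d j
wall-agree (wall c₀ c₁) e₀ e₁ = wall (trans (sym e₀) c₀) (trans (sym e₁) c₁)

enclosed-F : ∀ {l h} → Wall c l → Wall d l → Wall c h → Wall d h →
             AgreeOutside l (h + + 2) c d → AgreeOutside l (h + + 2) (F c) (F d)
enclosed-F {c} {d} {l} {h} wcl wdl wch wdh (agreeOutside below above) = agreeOutside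
  (λ i i<l → F-local c d i (below _ (ℤ.<-trans (i-1<i i) i<l)) (below i i<l) (right-of i i<l))
  (λ i h+2≤i → F-local c d i (left-of i h+2≤i) (above i h+2≤i)
                 (above _ (ℤ.≤-trans h+2≤i (ℤ.<⇒≤ (i<i+1 i)))))
  where
  h+2-1≡h+1 : ∀ h → h + + 2 - 1ℤ ≡ h + 1ℤ
  h+2-1≡h+1 = solve-∀
  h+1+1≡h+2 : ∀ h → h + 1ℤ + 1ℤ ≡ h + + 2
  h+1+1≡h+2 = solve-∀
  right-of : ∀ i → i < l → c (i + 1ℤ) ≡ d (i + 1ℤ)
  right-of i i<l with i + 1ℤ ℤ.≟ l
  ... | yes i+1≡l = subst (λ x → c x ≡ d x) (sym i+1≡l) (trans (Wall.left wcl) (sym (Wall.left wdl)))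
  ... | no  i+1≢l = below _ (ℤ.≤∧≢⇒< (<⇒+1≤ i<l) i+1≢l)
  left-of : ∀ i → h + + 2 ≤ i → c (i - 1ℤ) ≡ d (i - 1ℤ)
  left-of i h+2≤i with h + 1ℤ ℤ.≟ i - 1ℤ
  ... | yes h+1≡i-1 = subst (λ x → c x ≡ d x) h+1≡i-1 (trans (Wall.right wch) (sym (Wall.right wdh)))
  ... | no  h+1≢i-1 =
    above _ (subst (_≤ i - 1ℤ) (h+1+1≡h+2 h) (<⇒+1≤ (ℤ.≤∧≢⇒< h+1≤i-1 h+1≢i-1)))
    where
    h+1≤i-1 : h + 1ℤ ≤ i - 1ℤ
    h+1≤i-1 = subst (_≤ i - 1ℤ) (h+2-1≡h+1 h) (ℤ.+-monoˡ-≤ -1ℤ h+2≤i)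

enclosed-iterate : ∀ {l h} → Wall c l → Wall d l → Wall c h → Wall d h →
                   AgreeOutside l (h + + 2) c d → ∀ t →
                   AgreeOutside l (h + + 2) (iterate F t c) (iterate F t d)
enclosed-iterate wcl wdl wch wdh agree zero    = agree
enclosed-iterate wcl wdl wch wdh agree (suc t) =
  enclosed-F (wall-iterate t wcl) (wall-iterate t wdl) (wall-iterate t wch) (wall-iterate t wdh)
    (enclosed-iterate wcl wdl wch wdh agree t)

agreeOutside⇒diffWithin : ∀ {l h} → l ≤ h → AgreeOutside l h c d → DiffWithin ℤ.∣ h - l ∣ c d
agreeOutside⇒diffWithin {l = l} {h} l≤h (agreeOutside below above) = l , λ i cᵢ≢dᵢ →
  ℤ.≮⇒≥ (cᵢ≢dᵢ ∘ below i) ,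
  subst (i <_) (sym l+∣h-l∣≡h) (ℤ.≰⇒> (cᵢ≢dᵢ ∘ above i))
  where
  l+[h-l]≡h : ∀ l h → l + (h - l) ≡ h
  l+[h-l]≡h = solve-∀
  l+∣h-l∣≡h : l + + ℤ.∣ h - l ∣ ≡ h
  l+∣h-l∣≡h = trans (cong (λ x → l + x) (ℤ.0≤i⇒+∣i∣≡i (ℤ.i≤j⇒0≤j-i l≤h))) (l+[h-l]≡h l h)

DiffBounded : Config → Config → Set
DiffBounded c d = Σ ℕ λ w → ∀ t → DiffWithin w (iterate F t c) (iterate F t d)

-- The difference spreads at speed at most one until time T; by then it is
-- enclosed between two walls of the unperturbed configuration, which it
-- can never cross.
walled-diffBounded : ∀ T → AgreeOutside 0ℤ (+ n) c d → Walled (iterate F T c) → DiffBounded c d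
walled-diffBounded {n} {c} {d} T agree walled
  with walled (0ℤ - + T - 1ℤ - 1ℤ) | walled (+ n + + T)
... | (L , wallL , L≤) , _ | _ , (R , wallR , n+T≤R) =
  ℤ.∣ R + + 2 - L ∣ , λ t → agreeOutside⇒diffWithin L≤R+2 (enclosed t)
  where
  open AgreeOutside
  cone = agreeOutside-iterate agree
  L+1<-T : L + 1ℤ < 0ℤ - + T
  L+1<-T = ℤ.≤-<-trans (subst (L + 1ℤ ≤_) (i-1+1≡i _) (ℤ.+-monoˡ-≤ 1ℤ L≤)) (i-1<i _)
  L<-T : L < 0ℤ - + T
  L<-T = ℤ.<-trans (i<i+1 L) L+1<-T
  n+T≤R+2 : + n + + T ≤ R + + 2
  n+T≤R+2 = ℤ.≤-trans n+T≤R (ℤ.i≤i+j R (+ 2))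
  L≤R+2 : L ≤ R + + 2
  L≤R+2 = ℤ.≤-trans (ℤ.<⇒≤ L<-T)
                    (ℤ.≤-trans (ℤ.≤-trans (ℤ.i-j≤i 0ℤ (+ T)) (+≤+ z≤n)) n+T≤R+2)
  wallL′ : Wall (iterate F T d) L
  wallL′ = wall-agree wallL (below (cone T) L L<-T) (below (cone T) _ L+1<-T)
  wallR′ : Wall (iterate F T d) R
  wallR′ = wall-agree wallR (above (cone T) R n+T≤R)
                            (above (cone T) _ (ℤ.≤-trans n+T≤R (ℤ.<⇒≤ (i<i+1 R))))
  iterate-∸-+ : ∀ {t} c → T ℕ.≤ t → iterate F (t ℕ.∸ T) (iterate F T c) ≡ iterate F t c
  iterate-∸-+ {t} c T≤t =
    trans (sym (iterate-+ (t ℕ.∸ T) T c)) (cong (λ s → iterate F s c) (ℕ.m∸n+n≡m T≤t))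
  enclosed : ∀ t → AgreeOutside L (R + + 2) (iterate F t c) (iterate F t d)
  enclosed t with ℕ.≤-total t T
  ... | inj₁ t≤T = agreeOutside-widen
    (ℤ.≤-trans (ℤ.<⇒≤ L<-T) (ℤ.+-monoʳ-≤ 0ℤ (ℤ.neg-mono-≤ (+≤+ t≤T))))
    (ℤ.≤-trans (+≤+ (ℕ.+-monoʳ-≤ n t≤T)) n+T≤R+2) (cone t)
  ... | inj₂ T≤t = subst₂ (AgreeOutside L (R + + 2)) (iterate-∸-+ c T≤t) (iterate-∸-+ d T≤t)
    (enclosed-iterate wallL wallL′ wallR wallR′
      (agreeOutside-widen (ℤ.<⇒≤ L<-T) n+T≤R+2 (cone T)) (t ℕ.∸ T))

window : Config → ℤ → (m : ℕ) → Vec Bool m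
window c a zero    = []
window c a (suc m) = c a ∷ window c (a + 1ℤ) m

step : Vec Bool (2 ℕ.+ m) → Vec Bool m
step {zero}  (x ∷ y ∷ [])     = []
step {suc m} (x ∷ y ∷ z ∷ xs) = localRule 104 x y z ∷ step (y ∷ z ∷ xs)

steps : ∀ t → Vec Bool (t ℕ.* 2 ℕ.+ m) → Vec Bool m
steps zero    w = w
steps (suc t) w = steps t (step w)

window-F : ∀ c a m → window (F c) (a + 1ℤ) m ≡ step (window c a (2 ℕ.+ m))
window-F c a zero    = refl
window-F c a (suc m) =
  cong₂ _∷_ (cong (λ x → localRule 104 (c x) (c (a + 1ℤ)) (c (a + 1ℤ + 1ℤ))) (i+1-1≡i a))
            (window-F c (a + 1ℤ) m)

window-iterate : ∀ t c a m → window (iterate F t c) (a + + t) m ≡ steps t (window c a (t ℕ.* 2 ℕ.+ m))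
window-iterate zero    c a m = cong (λ x → window c x m) (ℤ.+-identityʳ a)
window-iterate (suc t) c a m = begin
  window (iterate F (suc t) c) (a + + suc t) m
    ≡⟨ cong₂ (λ e x → window e x m) (iterate-suc t c) (sym (a+1+n≡a+[1+n] a t)) ⟩
  window (iterate F t (F c)) (a + 1ℤ + + t) m     ≡⟨ window-iterate t (F c) (a + 1ℤ) m ⟩
  steps t (window (F c) (a + 1ℤ) (t ℕ.* 2 ℕ.+ m)) ≡⟨ cong (steps t) (window-F c a (t ℕ.* 2 ℕ.+ m)) ⟩
  steps (suc t) (window c a (suc t ℕ.* 2 ℕ.+ m))  ∎
  where open ≡-Reasoning

lookup-window : ∀ c a m (i : Fin m) → lookup (window c a m) i ≡ c (a + + Fin.toℕ i)
lookup-window c a (suc m) Fin.zero    = cong c (sym (ℤ.+-identityʳ a))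
lookup-window c a (suc m) (Fin.suc i) =
  trans (lookup-window c (a + 1ℤ) m i) (cong c (a+1+n≡a+[1+n] a (Fin.toℕ i)))

lookup-steps : ∀ t c a m (i : Fin m) →
               lookup (steps t (window c a (t ℕ.* 2 ℕ.+ m))) i ≡ iterate F t c (a + + (t ℕ.+ Fin.toℕ i))
lookup-steps t c a m i = begin
  lookup (steps t (window c a (t ℕ.* 2 ℕ.+ m))) i  ≡⟨ cong (λ w → lookup w i) (window-iterate t c a m) ⟨
  lookup (window (iterate F t c) (a + + t) m) i     ≡⟨ lookup-window (iterate F t c) (a + + t) m i ⟩
  iterate F t c (a + + t + + Fin.toℕ i)             ≡⟨ cong (iterate F t c) (ℤ.+-assoc a (+ t) (+ Fin.toℕ i)) ⟩
  iterate F t c (a + + (t ℕ.+ Fin.toℕ i))           ∎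
  where open ≡-Reasoning

window-++ : ∀ c a m n → window c a (m ℕ.+ n) ≡ window c a m ++ window c (a + + m) n
window-++ c a zero    n = cong (λ x → window c x n) (sym (ℤ.+-identityʳ a))
window-++ c a (suc m) n =
  cong (c a ∷_) (trans (window-++ c (a + 1ℤ) m n)
                       (cong (λ x → window c (a + 1ℤ) m ++ window c x n) (a+1+n≡a+[1+n] a m)))

window-agree : ∀ a m → (∀ i → i < a + + m → c i ≡ d i) → window c a m ≡ window d a m
window-agree a zero    agree = refl
window-agree a (suc m) agree = cong₂ _∷_
  (agree a (subst (_< a + + suc m) (ℤ.+-identityʳ a) (ℤ.+-monoʳ-< a (+<+ z<s))))
  (window-agree (a + 1ℤ) m (λ i i<a+1+m → agree i (subst (i <_) (a+1+n≡a+[1+n] a m) i<a+1+m)))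

hasWall : Vec Bool m → Bool
hasWall (x ∷ y ∷ xs) = (not x ∧ not y) ∨ hasWall (y ∷ xs)
hasWall _            = false

wallIn : ∀ t → Vec Bool (t ℕ.* 2 ℕ.+ m) → Bool
wallIn zero    w = false
wallIn (suc t) w = hasWall w ∨ wallIn t (step w)

T-∨-split : ∀ x {y} → T (x ∨ y) → T x ⊎ T y
T-∨-split x = Equivalence.to (T-∨ {x})

hasWall-window : ∀ c a m → T (hasWall (window c a m)) → ∃[ j ] Wall c j × j + 1ℤ < a + + m
hasWall-window c a zero ()
hasWall-window c a (suc zero) ()
hasWall-window c a (suc (suc m)) found =
  [ at-a , shift ∘ hasWall-window c (a + 1ℤ) (suc m) ]′ (T-∨-split (not (c a) ∧ not (c (a + 1ℤ))) found)
  where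
  at-a : T (not (c a) ∧ not (c (a + 1ℤ))) → ∃[ j ] Wall c j × j + 1ℤ < a + + suc (suc m)
  at-a here = let (c₀ , c₁) = Equivalence.to T-∧ here in
    a , wall (Equivalence.to T-not-≡ c₀) (Equivalence.to T-not-≡ c₁) ,
    ℤ.+-monoʳ-< a (+<+ (s≤s (s≤s z≤n)))
  shift : ∃[ j ] Wall c j × j + 1ℤ < a + 1ℤ + + suc m → ∃[ j ] Wall c j × j + 1ℤ < a + + suc (suc m)
  shift (j , wallⱼ , j+1<) = j , wallⱼ , subst (j + 1ℤ <_) (a+1+n≡a+[1+n] a (suc m)) j+1<

wallIn-window : ∀ t c a m → T (wallIn t (window c a (t ℕ.* 2 ℕ.+ m))) →
                ∃[ s ] s ℕ.< t × ∃[ j ] Wall (iterate F s c) j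
wallIn-window zero c a m ()
wallIn-window (suc t) c a m found with T-∨-split (hasWall (window c a (2 ℕ.+ (t ℕ.* 2 ℕ.+ m)))) found
... | inj₁ now   =
  let (j , wallⱼ , _) = hasWall-window c a (2 ℕ.+ (t ℕ.* 2 ℕ.+ m)) now in 0 , z<s , j , wallⱼ
... | inj₂ later =
  let (s , s<t , j , wallⱼ) = wallIn-window t (F c) (a + 1ℤ) m
                                (subst (T ∘ wallIn t) (sym (window-F c a (t ℕ.* 2 ℕ.+ m))) later)
  in suc s , s≤s s<t , j , subst (λ e → Wall e j) (sym (iterate-suc s c)) wallⱼ

-- The local facts about rule 104 used below are Boolean checks on windows,
-- verified by evaluating them on every window of the relevant size.
every : ∀ n → (Vec Bool n → Bool) → Bool
every zero    P = P []
every (suc n) P = every n (P ∘ (true ∷_)) ∧ every n (P ∘ (false ∷_))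

every-sound : ∀ n P → T (every n P) → ∀ v → T (P v)
every-sound zero    P holds []          = holds
every-sound (suc n) P holds (true ∷ v)  = every-sound n _ (proj₁ (Equivalence.to T-∧ holds)) v
every-sound (suc n) P holds (false ∷ v) = every-sound n _ (proj₂ (Equivalence.to T-∧ holds)) v

-- Wall-free backgrounds

-- Four steps without a wall already imply that no wall ever appears.
WallFree : Config → Set
WallFree c = ∀ s → s ℕ.< 4 → NoWall (iterate F s c)

period-two-check : Vec Bool 9 → Bool
period-two-check w = wallIn 4 w ∨ ⌊ lookup (steps 2 w) (# 2) ≟ᵇ lookup w (# 4) ⌋

wallFree⇒period-two : WallFree c → F (F c) ≗ c
wallFree⇒period-two {c} wallFree i =
  [ ⊥-elim ∘ no-wall , centre ]′ (T-∨-split (wallIn 4 w) (every-sound 9 period-two-check tt w))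
  where
  start = i - + 4
  w = window c start 9
  no-wall : ¬ T (wallIn 4 w)
  no-wall found = let (s , s<4 , j , wallⱼ) = wallIn-window 4 c start 1 found in wallFree s s<4 j wallⱼ
  centre : T ⌊ lookup (steps 2 w) (# 2) ≟ᵇ lookup w (# 4) ⌋ → F (F c) i ≡ c i
  centre same = subst (λ x → F (F c) x ≡ c x) (i-a+a≡i i (+ 4))
    (trans (sym (lookup-steps 2 c start 5 (# 2))) (trans (toWitness same) (lookup-steps 0 c start 9 (# 4))))

wallFree-forever : WallFree c → ∀ t → NoWall (iterate F t c)
wallFree-forever wallFree zero          = wallFree 0 (s≤s z≤n)
wallFree-forever wallFree (suc zero)    = wallFree 1 (s≤s (s≤s z≤n))
wallFree-forever {c} wallFree (suc (suc t)) j wallⱼ =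
  wallFree-forever wallFree t j (wall-≗ two-steps-back wallⱼ)
  where
  two-steps-back : iterate F (2 ℕ.+ t) c ≗ iterate F t c
  two-steps-back x =
    trans (cong (λ e → e x) (trans (iterate-suc (suc t) c) (iterate-suc t (F c))))
          (iterate-cong t (wallFree⇒period-two wallFree) x)

-- w is the common part of the windows of c and d left of the first difference.
difference-check : Vec Bool 6 → Vec Bool 3 → Vec Bool 3 → Bool
difference-check w x y = ⌊ head x ≟ᵇ head y ⌋ ∨ wallIn 4 (w ++ x) ∨ wallIn 4 (w ++ y)

difference-check-holds : ∀ w x y → T (difference-check w x y)
difference-check-holds w x y =
  every-sound 3 (difference-check w x)
    (every-sound 3 (λ x → every 3 (difference-check w x))
      (every-sound 6 (λ w → every 3 (λ x → every 3 (difference-check w x))) tt w) x) y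

difference-creates-wall : WallFree c → (∀ i → i < p → c i ≡ d i) →
                          c p ≢ d p → ∃[ s ] ∃[ j ] Wall (iterate F s d) j
difference-creates-wall {c} {p} {d} wallFree agree differ =
  [ ⊥-elim ∘ differ ∘ toWitness
  , [ ⊥-elim ∘ background-wall , foreground-wall ]′
      ∘ T-∨-split (wallIn 4 (window c start 6 ++ window c p 3))
  ]′ (T-∨-split ⌊ c p ≟ᵇ d p ⌋ (difference-check-holds (window c start 6) (window c p 3) (window d p 3)))
  where
  start = p - + 6
  split : ∀ e → window e start 6 ++ window e p 3 ≡ window e start 9
  split e = sym (trans (window-++ e start 6 3) (cong (λ x → window e start 6 ++ window e x 3) (i-a+a≡i p (+ 6))))
  same-prefix : window c start 6 ≡ window d start 6
  same-prefix = window-agree start 6 (λ i i<start+6 → agree i (subst (i <_) (i-a+a≡i p (+ 6)) i<start+6))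
  background-wall : ¬ T (wallIn 4 (window c start 6 ++ window c p 3))
  background-wall found =
    let (s , s<4 , j , wallⱼ) = wallIn-window 4 c start 1 (subst (T ∘ wallIn 4) (split c) found)
    in wallFree s s<4 j wallⱼ
  foreground-wall : T (wallIn 4 (window c start 6 ++ window d p 3)) → ∃[ s ] ∃[ j ] Wall (iterate F s d) j
  foreground-wall found =
    let found′ = subst (λ w → T (wallIn 4 (w ++ window d p 3))) same-prefix found
        (s , _ , j , wallⱼ) = wallIn-window 4 d start 1 (subst (T ∘ wallIn 4) (split d) found′)
    in s , j , wallⱼ

-- For the window starting at p - 4: either p, p + 1 is not a wall, or cell p - 1
-- is 0 after one, two or three steps.
wall-absent-or-grown : Vec Bool 7 → Bool
wall-absent-or-grown w =
  lookup w (# 4) ∨ lookup w (# 5) ∨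
  not (lookup (steps 1 w) (# 2)) ∨ not (lookup (steps 2 w) (# 1)) ∨ not (lookup (steps 3 w) (# 0))

advance-check : Vec Bool 5 → Vec Bool 2 → Bool
advance-check w₅ w₂ = hasWall w₅ ∨ wall-absent-or-grown (w₅ ++ w₂)

advance-check-holds : ∀ w₅ w₂ → T (advance-check w₅ w₂)
advance-check-holds w₅ w₂ =
  every-sound 2 (advance-check w₅) (every-sound 5 (λ w₅ → every 2 (advance-check w₅)) tt w₅) w₂

-- Within three steps a wall either grows by one cell to the left, or
-- another wall already lies to its left.
wall-advances : Wall c p → ∃[ s ] ∃[ j ] Wall (iterate F s c) j × j < p
wall-advances {c} {p} wallₚ =
  [ further-left , grown ∘ subst (T ∘ wall-absent-or-grown) (sym (window-++ c start 5 2)) ]′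
    (T-∨-split (hasWall (window c start 5)) (advance-check-holds (window c start 5) (window c (start + + 5) 2)))
  where
  start = p - + 4
  start+4≡p : start + + 4 ≡ p
  start+4≡p = i-a+a≡i p (+ 4)
  start+5≡p+1 : ∀ p → p - + 4 + + 5 ≡ p + 1ℤ
  start+5≡p+1 = solve-∀
  start+3≡p-1 : ∀ p → p - + 4 + + 3 ≡ p - 1ℤ
  start+3≡p-1 = solve-∀
  further-left : T (hasWall (window c start 5)) → ∃[ s ] ∃[ j ] Wall (iterate F s c) j × j < p
  further-left found = let (j , wallⱼ , j+1<start+5) = hasWall-window c start 5 found in
    0 , j , wallⱼ , +1<+1⇒< (subst (j + 1ℤ <_) (start+5≡p+1 p) j+1<start+5)
  on-left : ∀ s → T (not (iterate F s c (start + + 3))) → ∃[ s ] ∃[ j ] Wall (iterate F s c) j × j < p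
  on-left s cleared = s , p - 1ℤ ,
    wall (subst (λ x → iterate F s c x ≡ false) (start+3≡p-1 p) (Equivalence.to T-not-≡ cleared))
         (subst (λ x → iterate F s c x ≡ false) (sym (i-1+1≡i p)) (Wall.left (wall-iterate s wallₚ))) ,
    i-1<i p
  absurd : ∀ x → c x ≡ false → ¬ T (c x)
  absurd x c[x]≡false = subst T c[x]≡false
  grown : T (wall-absent-or-grown (window c start 7)) → ∃[ s ] ∃[ j ] Wall (iterate F s c) j × j < p
  grown h with T-∨-split (lookup (window c start 7) (# 4)) h
  ... | inj₁ one =
    ⊥-elim (absurd (start + + 4) (subst (λ x → c x ≡ false) (sym start+4≡p) (Wall.left wallₚ))
                             (subst T (lookup-steps 0 c start 7 (# 4)) one))
  ... | inj₂ h with T-∨-split (lookup (window c start 7) (# 5)) h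
  ... | inj₁ one =
    ⊥-elim (absurd (start + + 5) (subst (λ x → c x ≡ false) (sym (start+5≡p+1 p)) (Wall.right wallₚ))
                             (subst T (lookup-steps 0 c start 7 (# 5)) one))
  ... | inj₂ h with T-∨-split (not (lookup (steps 1 (window c start 7)) (# 2))) h
  ... | inj₁ cleared = on-left 1 (subst (T ∘ not) (lookup-steps 1 c start 5 (# 2)) cleared)
  ... | inj₂ h with T-∨-split (not (lookup (steps 2 (window c start 7)) (# 1))) h
  ... | inj₁ cleared = on-left 2 (subst (T ∘ not) (lookup-steps 2 c start 3 (# 1)) cleared)
  ... | inj₂ cleared = on-left 3 (subst (T ∘ not) (lookup-steps 3 c start 1 (# 0)) cleared)

walls-drift-left : Wall c j → ∀ k → ∃[ s ] ∃[ i ] Wall (iterate F s c) i × i + + k ≤ j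
walls-drift-left {j = j} wallⱼ zero = 0 , j , wallⱼ , ℤ.≤-reflexive (ℤ.+-identityʳ j)
walls-drift-left {c} {j} wallⱼ (suc k) = further (walls-drift-left wallⱼ k)
  where
  further : ∃[ s ] ∃[ i ] Wall (iterate F s c) i × i + + k ≤ j →
            ∃[ s ] ∃[ i ] Wall (iterate F s c) i × i + + suc k ≤ j
  further (s , i , wallᵢ , i+k≤j) =
    let (s′ , i′ , wallᵢ′ , i′<i) = wall-advances wallᵢ in
    s′ ℕ.+ s , i′ , subst (λ e → Wall e i′) (sym (iterate-+ s′ s c)) wallᵢ′ ,
    ℤ.≤-trans (subst (_≤ i + + k) (a+1+n≡a+[1+n] i′ k) (ℤ.+-monoˡ-≤ (+ k) (<⇒+1≤ i′<i))) i+k≤j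

wall-marks-difference : NoWall c → Wall d j → ∃[ i ] (j ≤ i × i ≤ j + 1ℤ) × c i ≢ d i
wall-marks-difference {c} {d} {j} noWall (wall d₀ d₁) with c j ≟ᵇ false | c (j + 1ℤ) ≟ᵇ false
... | yes c₀ | yes c₁ = ⊥-elim (noWall j (wall c₀ c₁))
... | no ¬c₀ | _      = j , (ℤ.≤-refl , ℤ.<⇒≤ (i<i+1 j)) , λ eq → ¬c₀ (trans eq d₀)
... | _      | no ¬c₁ = j + 1ℤ , (ℤ.<⇒≤ (i<i+1 j) , ℤ.≤-refl) , λ eq → ¬c₁ (trans eq d₁)

diffWithin-spread : ∀ {w i i′} → DiffWithin w c d → c i ≢ d i → c i′ ≢ d i′ → i′ < i + + w
diffWithin-spread {w = w} {i} {i′} (a , within) differ differ′ =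
  ℤ.<-≤-trans (proj₂ (within i′ differ′)) (ℤ.+-monoˡ-≤ (+ w) (proj₁ (within i differ)))

-- A wall in the perturbed configuration drifts left without bound while
-- staying in place on the right; a wall-free background differs from it
-- at both ends.
wall⇒¬diffBounded : ∀ t₀ → (∀ t → NoWall (iterate F t c)) → Wall (iterate F t₀ d) j →
                    ¬ DiffBounded c d
wall⇒¬diffBounded {c} {d} {j₀} t₀ noWall wall₀ (w , within) = ℤ.<-irrefl refl j₀<j₀
  where
  drift = walls-drift-left wall₀ (suc w)
  s = proj₁ drift
  jₛ = proj₁ (proj₂ drift)
  at-t : ∀ {i} → Wall (iterate F s (iterate F t₀ d)) i → Wall (iterate F (s ℕ.+ t₀) d) i
  at-t {i} = subst (λ e → Wall e i) (sym (iterate-+ s t₀ d))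
  left  = wall-marks-difference (noWall (s ℕ.+ t₀)) (at-t (proj₁ (proj₂ (proj₂ drift))))
  right = wall-marks-difference (noWall (s ℕ.+ t₀)) (at-t (wall-iterate s wall₀))
  j₀<j₀ : j₀ < j₀
  j₀<j₀ = begin-strict
    j₀               ≤⟨ proj₁ (proj₁ (proj₂ right)) ⟩
    proj₁ right      <⟨ diffWithin-spread (within (s ℕ.+ t₀)) (proj₂ (proj₂ left)) (proj₂ (proj₂ right)) ⟩
    proj₁ left + + w ≤⟨ ℤ.+-monoˡ-≤ (+ w) (proj₂ (proj₁ (proj₂ left))) ⟩
    jₛ + 1ℤ + + w    ≡⟨ a+1+n≡a+[1+n] jₛ w ⟩
    jₛ + + suc w     ≤⟨ proj₂ (proj₂ (proj₂ drift)) ⟩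
    j₀               ∎
    where open ℤ.≤-Reasoning

wallFree-¬diffBounded : WallFree c → (∀ i → i < p → c i ≡ d i) →
                     c p ≢ d p → ¬ DiffBounded c d
wallFree-¬diffBounded wallFree agree differ =
  let (t₀ , j₀ , wall₀) = difference-creates-wall wallFree agree differ
  in wall⇒¬diffBounded t₀ (wallFree-forever wallFree) wall₀

first-difference : ∀ a n → (∀ i → i < a → c i ≡ d i) → window c a n ≢ window d a n →
                   ∃[ p ] (∀ i → i < p → c i ≡ d i) × c p ≢ d p
first-difference a zero agree differ = ⊥-elim (differ refl)
first-difference {c} {d} a (suc n) agree differ with c a ≟ᵇ d a
... | no  cₐ≢dₐ = a , agree , cₐ≢dₐ
... | yes cₐ≡dₐ = first-difference (a + 1ℤ) n agree′ (differ ∘ cong₂ _∷_ cₐ≡dₐ)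
  where
  agree′ : ∀ i → i < a + 1ℤ → c i ≡ d i
  agree′ i i<a+1 with i ℤ.≟ a
  ... | yes refl = cₐ≡dₐ
  ... | no  i≢a  = agree i (ℤ.≤∧≢⇒< (<+1⇒≤ i<a+1) i≢a)

-- Perturbations of p_u

module _ {k : ℕ} (u : Vec Bool (suc k)) where

  patch-inside : ∀ {n} (x : Vec Bool n) (m<n : m ℕ.< n) → patch u x (+ m) ≡ lookup x (fromℕ< m<n)
  patch-inside {m} {n} x m<n with m ℕ.<? n
  ... | yes _   = refl
  ... | no  m≮n = contradiction m<n m≮n

  patch-outside : ∀ {n} (x : Vec Bool n) → AgreeOutside 0ℤ (+ n) (periodic u) (patch u x)
  patch-outside {n} x = agreeOutside below above
    where
    below : ∀ i → i < 0ℤ → periodic u i ≡ patch u x i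
    below -[1+ _ ] _  = refl
    below (+ _) (+<+ ())
    above : ∀ i → + n ≤ i → periodic u i ≡ patch u x i
    above (+ m) (+≤+ n≤m) with m ℕ.<? n
    ... | yes m<n = contradiction m<n (ℕ.≤⇒≯ n≤m)
    ... | no  _   = refl

  window-patch : ∀ {n} (x : Vec Bool n) → window (patch u x) 0ℤ n ≡ x
  window-patch {n} x = begin
    window (patch u x) 0ℤ n                  ≡⟨ tabulate∘lookup _ ⟨
    tabulate (lookup (window (patch u x) 0ℤ n)) ≡⟨ tabulate-cong lookup-agrees ⟩
    tabulate (lookup x)                      ≡⟨ tabulate∘lookup x ⟩
    x                                        ∎
    where
    open ≡-Reasoning
    lookup-agrees : lookup (window (patch u x) 0ℤ n) ≗ lookup x
    lookup-agrees i = begin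
      lookup (window (patch u x) 0ℤ n) i       ≡⟨ lookup-window (patch u x) 0ℤ n i ⟩
      patch u x (+ Fin.toℕ i)                  ≡⟨ patch-inside x (Finₚ.toℕ<n i) ⟩
      lookup x (fromℕ< (Finₚ.toℕ<n i))         ≡⟨ cong (lookup x) (Finₚ.fromℕ<-toℕ i (Finₚ.toℕ<n i)) ⟩
      lookup x i                               ∎

  periodic≗patch : ∀ {n} (x : Vec Bool n) → x ≡ window (periodic u) 0ℤ n → periodic u ≗ patch u x
  periodic≗patch x refl -[1+ _ ] = refl
  periodic≗patch {n} x refl (+ m) with m ℕ.<? n
  ... | yes m<n = sym (trans (lookup-window (periodic u) 0ℤ n (fromℕ< m<n))
                             (cong (periodic u ∘ +_) (Finₚ.toℕ-fromℕ< m<n)))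
  ... | no  _   = refl

  iterates-periodic : ∀ s → Periodic (suc k) (iterate F s (periodic u))
  iterates-periodic s = periodic-iterate s (periodic-periodic u)

  walled-or-wallFree : (∃[ T ] Walled (iterate F T (periodic u))) ⊎ WallFree (periodic u)
  walled-or-wallFree
    with ℕ.anyUpTo? (λ s → ℕ.anyUpTo? (λ q → wall? (iterate F s (periodic u)) (+ q)) (suc k)) 4
  ... | yes (s , _ , q , _ , wall₀) = inj₁ (s , periodic-walled (iterates-periodic s) wall₀)
  ... | no  none = inj₂ λ s s<4 j wallⱼ →
    none (s , s<4 , j %ℕ suc k , n%ℕd<d j (suc k) , wall-%ℕ (iterates-periodic s) wallⱼ)

  wallFree-diffBounded⇔ : WallFree (periodic u) → ∀ {n} (x : Vec Bool n) →
                          DiffBounded (periodic u) (patch u x) ⇔ x ≡ window (periodic u) 0ℤ n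
  wallFree-diffBounded⇔ wallFree {n} x = mk⇔ to from
    where
    to : DiffBounded (periodic u) (patch u x) → x ≡ window (periodic u) 0ℤ n
    to bounded = decidable-stable (≡-dec _≟ᵇ_ x (window (periodic u) 0ℤ n)) λ x≢ →
      let (p , agree , differ) = first-difference 0ℤ n (AgreeOutside.below (patch-outside x))
                                   (λ eq → x≢ (trans (sym (window-patch x)) (sym eq)))
      in wallFree-¬diffBounded wallFree agree differ bounded
    from : x ≡ window (periodic u) 0ℤ n → DiffBounded (periodic u) (patch u x)
    from x≡ = 0 , λ t → 0ℤ , λ i differ → ⊥-elim (differ (iterate-cong t (periodic≗patch x x≡) i))

both : ∀ {X Y : Set} → (X → Bool) → (Y → Bool) → Protocol X Y Bool
both f g = alice f (leaf false) (bob g (leaf false) (leaf true))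

run-both : ∀ {X Y : Set} (f : X → Bool) (g : Y → Bool) x y → run (both f g) x y ≡ f x ∧ g y
run-both f g x y with f x | g y
... | true  | true  = refl
... | true  | false = refl
... | false | _     = refl

∧-true⇔ : ∀ {A B : Set} (a? : Dec A) (b? : Dec B) → (⌊ a? ⌋ ∧ ⌊ b? ⌋ ≡ true) ⇔ (A × B)
∧-true⇔ (yes a) (yes b) = mk⇔ (λ _ → a , b) (λ _ → refl)
∧-true⇔ (yes _) (no ¬b) = mk⇔ (λ ()) (⊥-elim ∘ ¬b ∘ proj₂)
∧-true⇔ (no ¬a) _       = mk⇔ (λ ()) (⊥-elim ∘ ¬a ∘ proj₁)

both-computes : ∀ {X Y : Set} {A : X → Set} {B : Y → Set}
                (A? : ∀ x → Dec (A x)) (B? : ∀ y → Dec (B y)) →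
                ComputesPred (both (⌊_⌋ ∘ A?) (⌊_⌋ ∘ B?)) (λ x y → A x × B y)
both-computes A? B? x y =
  subst (λ b → (b ≡ true) ⇔ _) (sym (run-both (⌊_⌋ ∘ A?) (⌊_⌋ ∘ B?) x y)) (∧-true⇔ (A? x) (B? y))

++-≡-window⇔ : ∀ c {i j} (x : Vec Bool i) (y : Vec Bool j) →
               (x ++ y ≡ window c 0ℤ (i ℕ.+ j)) ⇔ (x ≡ window c 0ℤ i × y ≡ window c (+ i) j)
++-≡-window⇔ c {i} {j} x y =
  subst (λ w → (x ++ y ≡ w) ⇔ (x ≡ window c 0ℤ i × y ≡ window c (+ i) j)) (sym (window-++ c 0ℤ i j))
  (mk⇔ (++-injective x (window c 0ℤ i)) λ (x≡ , y≡) → cong₂ _++_ x≡ y≡)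

proposition17 : ∀ (k : ℕ) (u : Vec Bool (suc k)) →
    Σ ℕ λ C → Σ ℕ λ n₀ → ∀ (n : ℕ) → n₀ ℕ.≤ n →
      DLe (λ x → SInv (ECA 104) u x) n C
proposition17 k u with walled-or-wallFree u
... | inj₁ (T , walled) = 0 , 0 , λ _ _ i j _ →
  leaf true , z≤n ,
  λ x y → mk⇔ (λ _ → walled-diffBounded T (patch-outside u (x ++ y)) walled) (λ _ → refl)
... | inj₂ wallFree = 2 , 0 , λ _ _ i j _ →
  both (⌊_⌋ ∘ matches? 0ℤ i) (⌊_⌋ ∘ matches? (+ i) j) , ℕ.≤-refl ,
  λ x y → ⇔-trans (both-computes (matches? 0ℤ i) (matches? (+ i) j) x y)
            (⇔-trans (⇔-sym (++-≡-window⇔ (periodic u) x y))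
                     (⇔-sym (wallFree-diffBounded⇔ u wallFree (x ++ y))))
  where
  matches? : ∀ a m (x : Vec Bool m) → Dec (x ≡ window (periodic u) a m)
  matches? a m x = ≡-dec _≟ᵇ_ x (window (periodic u) a m)
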